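{- Let $n\ge 2$ and let $P_n$ be the path on $n$ vertices. For an integer $k$ with $1 \le k \le n/2$, let $M(n,k)$ denote the smallest diameter of a graph obtained from $P_n$ by adding $k$ matching edges. Then $$M(n,k) \;\ge\; \frac{n}{2(k+1)} + \log_2(k+1) - 2 .$$
   Context: All graphs are simple, undirected and unweighted; the distance between two vertices is the number of edges on a shortest path, and the diameter is the maximum distance over all pairs of vertices. "Adding $k$ matching edges" to a graph means adding $k$ new edges (pairs of vertices not already adjacent) such that every vertex is incident to at most one of the new edges, i.e., the new edges form a matching. -}

module Defs where

open import Data.Nat using (ℕ; zero; suc; _+_)
open import Data.Fin using (Fin; toℕ)
open import Data.Vec using (Vec; lookup)
open import Data.Product using (_×_; Σ; proj₁; proj₂)
open import Data.Sum using (_⊎_)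
open import Relation.Binary.PropositionalEquality using (_≡_; _≢_)
open import Relation.Nullary using (¬_)

PathAdj : {n : ℕ} → Fin n → Fin n → Set
PathAdj u v = (toℕ u + 1 ≡ toℕ v) ⊎ (toℕ v + 1 ≡ toℕ u)

Edges : ℕ → ℕ → Set
Edges n k = Vec (Fin n × Fin n) k

Endpoint : {n k : ℕ} → Edges n k → Fin k → Fin n → Set
Endpoint m i x = (x ≡ proj₁ (lookup m i)) ⊎ (x ≡ proj₂ (lookup m i))

-- The k extra edges are valid "matching edges" to add to P_n:
--  * each joins two distinct vertices that are not already adjacent in P_n,
--  * every vertex is an endpoint of at most one of the new edges
--    (so the k new edges are pairwise disjoint, hence k distinct edges).
IsAddedMatching : {n k : ℕ} → Edges n k → Set
IsAddedMatching {n} {k} m =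
  ((i : Fin k) → proj₁ (lookup m i) ≢ proj₂ (lookup m i))
  × ((i : Fin k) → ¬ PathAdj (proj₁ (lookup m i)) (proj₂ (lookup m i)))
  × ((i j : Fin k) (x : Fin n) → Endpoint m i x → Endpoint m j x → i ≡ j)

Adj : {n k : ℕ} → Edges n k → Fin n → Fin n → Set
Adj {n} {k} m u v =
  PathAdj u v
  ⊎ Σ (Fin k) (λ i → ((u ≡ proj₁ (lookup m i)) × (v ≡ proj₂ (lookup m i)))
                   ⊎ ((v ≡ proj₁ (lookup m i)) × (u ≡ proj₂ (lookup m i))))

WithinDist : {n k : ℕ} → Edges n k → ℕ → Fin n → Fin n → Set
WithinDist m zero    u v = u ≡ v
WithinDist {n} m (suc d) u v = (u ≡ v) ⊎ Σ (Fin n) (λ w → Adj m u w × WithinDist m d w v)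

DiamAtMost : {n k : ℕ} → Edges n k → ℕ → Set
DiamAtMost {n} m d = (u v : Fin n) → WithinDist m d u v

{-# OPTIONS --safe #-}
-- Run breadth-first search from the end vertex 0 of the path. A vertex of P_n + m has at
-- most three neighbours, one per side (left, right, across its matching edge), and one
-- side of every vertex is used by its parent (at 0, the missing left side). Hence a
-- vertex has at most two children, and at most one unless it is one of the 2k matching
-- endpoints. Layer s therefore has at most 2^s vertices, and at most 1 + 2k vertices in
-- general. With 2^E ≤ 2k < 2^(E+1), the first E layers hold fewer than 2k vertices and
-- each of the remaining d + 1 − E layers at most 2k + 1, which forces
-- n + 2(k+1)E ≤ 2(k+1)(d+2); and k + 1 ≤ 2^E turns this into the stated bound.
module Submission where

open import Defs
open import Data.Nat using (ℕ; zero; suc; _+_; _*_; _∸_; _^_; _≤_; _<_; z≤n; s≤s)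
open import Data.Nat.Properties
open import Data.Nat.Tactic.RingSolver using (solve-∀)
open import Data.Fin using (Fin; toℕ) renaming (zero to fzero; suc to fsuc)
import Data.Fin.Properties as Finₚ
open import Data.Vec using (Vec; []; _∷_; lookup)
import Data.Vec.Relation.Unary.Unique.Propositional as Vec
open import Data.Vec.Relation.Unary.AllPairs using ([]; _∷_)
open import Data.Vec.Relation.Unary.All using ([]; _∷_)
open import Data.Vec.Relation.Unary.Unique.Propositional.Properties using (lookup-injective)
open import Data.List using (List; []; _∷_; _++_; length; filter; map; allFin)
open import Data.List.Properties using (length-++; length-map; length-tabulate; filter-all)
open import Data.List.Membership.Propositional using (_∈_)
open import Data.List.Membership.Propositional.Properties
  using (∈-∃++; ∈-++⁻; ∈-++⁺ˡ; ∈-++⁺ʳ; ∈-map⁺; ∈-filter⁺; ∈-filter⁻; ∈-allFin)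
open import Data.List.Relation.Unary.Any using (here; there)
import Data.List.Relation.Unary.All as All
open import Data.List.Relation.Unary.AllPairs using ([]; _∷_)
open import Data.List.Relation.Unary.Unique.Propositional using (Unique)
open import Data.List.Relation.Unary.Unique.Propositional.Properties using (filter⁺; allFin⁺)
open import Data.Product using (_×_; Σ; _,_; proj₁; proj₂)
open import Data.Sum using (_⊎_; inj₁; inj₂; [_,_]′)
open import Data.Sum.Properties using (inj₁-injective; inj₂-injective)
open import Data.Unit using (tt)
open import Data.Empty using (⊥; ⊥-elim)
open import Function using (_∘_; id)
open import Relation.Binary.PropositionalEquality
open import Relation.Nullary using (¬_; Dec; yes; no; contradiction)
open import Relation.Nullary.Decidable using (_×-dec_; _⊎-dec_)
open import Relation.Unary using (Decidable; U; _∩_)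
open import Relation.Unary.Properties using (U?; _∩?_; ∁?)

record Least (P : ℕ → Set) : Set where
  field
    value   : ℕ
    holds   : P value
    minimal : ∀ {j} → P j → value ≤ j

least : {P : ℕ → Set} → Decidable P → (b : ℕ) → P b → Least P
least P? b Pb with P? 0
... | yes P0 = record { value = 0 ; holds = P0 ; minimal = λ _ → z≤n }
least P? zero    Pb | no ¬P0 = contradiction Pb ¬P0
least {P} P? (suc b) Pb | no ¬P0 = record { value = suc value ; holds = holds ; minimal = minimal′ }
  where
  open Least (least (P? ∘ suc) b Pb)
  minimal′ : ∀ {j} → P j → suc value ≤ j
  minimal′ {zero}  P0 = contradiction P0 ¬P0
  minimal′ {suc j} Pj = s≤s (minimal Pj)

log₂-bracket : ∀ k → 1 ≤ k → Σ ℕ λ e → 2 ^ e ≤ k × k < 2 ^ suc e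
log₂-bracket (suc zero)    _ = 0 , ≤-refl , s≤s (s≤s z≤n)
log₂-bracket (suc (suc k)) _ with e , 2^e≤1+k , 1+k<2^[1+e] ← log₂-bracket (suc k) (s≤s z≤n)
  with m≤n⇒m<n∨m≡n 1+k<2^[1+e]
... | inj₁ 2+k<2^[1+e] = e , m≤n⇒m≤1+n 2^e≤1+k , 2+k<2^[1+e]
... | inj₂ 2+k≡2^[1+e] = suc e , ≤-reflexive (sym 2+k≡2^[1+e])
  , subst (_< 2 ^ suc (suc e)) (sym 2+k≡2^[1+e]) (^-monoʳ-< 2 (s≤s (s≤s z≤n)) (n<1+n (suc e)))

Unique⇒≤ : ∀ {m n} {xs : Vec (Fin n) m} → Vec.Unique xs → m ≤ n
Unique⇒≤ uniq = Finₚ.injective⇒≤ (λ {i} {j} → lookup-injective uniq i j)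

module _ {A B : Set} where

  ∈-++-∷⁻ : ∀ {x y : B} hs {ts} → x ∈ hs ++ y ∷ ts → x ≢ y → x ∈ hs ++ ts
  ∈-++-∷⁻ hs x∈ x≢y with ∈-++⁻ hs x∈
  ... | inj₁ x∈hs         = ∈-++⁺ˡ x∈hs
  ... | inj₂ (here x≡y)   = contradiction x≡y x≢y
  ... | inj₂ (there x∈ts) = ∈-++⁺ʳ hs x∈ts

  length-++-∷ : ∀ hs {y : B} ts → length (hs ++ y ∷ ts) ≡ suc (length (hs ++ ts))
  length-++-∷ hs ts = begin
    length (hs ++ _ ∷ ts)          ≡⟨ length-++ hs ⟩
    length hs + suc (length ts)    ≡⟨ +-suc (length hs) (length ts) ⟩
    suc (length hs + length ts)    ≡⟨ cong suc (length-++ hs) ⟨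
    suc (length (hs ++ ts))        ∎
    where open ≡-Reasoning

  injection⇒length≤ : ∀ (xs : List A) (ys : List B) → Unique xs →
    (f : ∀ {x} → x ∈ xs → B) → (∀ {x} (x∈ : x ∈ xs) → f x∈ ∈ ys) →
    (∀ {x y} (x∈ : x ∈ xs) (y∈ : y ∈ xs) → f x∈ ≡ f y∈ → x ≡ y) →
    length xs ≤ length ys
  injection⇒length≤ []       ys _              _ _     _     = z≤n
  injection⇒length≤ (x ∷ xs) ys (x∉xs ∷ uniq) f f∈ys f-inj
    with hs , ts , refl ← ∈-∃++ (f∈ys (here refl)) =
    subst (suc (length xs) ≤_) (sym (length-++-∷ hs ts))
      (s≤s (injection⇒length≤ xs (hs ++ ts) uniq (f ∘ there) f∈hs++ts
              (λ p q → f-inj (there p) (there q))))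
    where
    f∈hs++ts : ∀ {y} (y∈ : y ∈ xs) → f (there y∈) ∈ hs ++ ts
    f∈hs++ts y∈ = ∈-++-∷⁻ hs (f∈ys (there y∈))
      (λ fy≡fx → All.lookup x∉xs y∈ (sym (f-inj (there y∈) (here refl) fy≡fx)))

module _ {A : Set} {P Q : A → Set} (P? : Decidable P) (Q? : Decidable Q) where

  length-filter-split : ∀ xs →
    length (filter P? xs) ≡ length (filter (P? ∩? Q?) xs) + length (filter (P? ∩? ∁? Q?) xs)
  length-filter-split []       = refl
  length-filter-split (x ∷ xs) with P? x | Q? x
  ... | yes _ | yes _ = cong suc (length-filter-split xs)
  ... | yes _ | no  _ = trans (cong suc (length-filter-split xs)) (sym (+-suc _ _))
  ... | no  _ | yes _ = length-filter-split xs
  ... | no  _ | no  _ = length-filter-split xs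

module _ {n : ℕ} where

  count : {P : Fin n → Set} → Decidable P → ℕ
  count P? = length (filter P? (allFin n))

  count-injection : {P : Fin n → Set} (P? : Decidable P) {B : Set} (ys : List B)
    (f : ∀ {u} → P u → B) → (∀ {u} (p : P u) → f p ∈ ys) →
    (∀ {u v} (p : P u) (q : P v) → f p ≡ f q → u ≡ v) → count P? ≤ length ys
  count-injection {P} P? ys f f∈ys f-inj =
    injection⇒length≤ (filter P? (allFin n)) ys (filter⁺ P? (allFin⁺ n))
      (f ∘ P-of) (f∈ys ∘ P-of) (λ p q → f-inj (P-of p) (P-of q))
    where
    P-of : ∀ {u} → u ∈ filter P? (allFin n) → P u
    P-of = proj₂ ∘ ∈-filter⁻ P? {xs = allFin n}

  count-mono : {P Q : Fin n → Set} (P? : Decidable P) (Q? : Decidable Q) →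
    (∀ {u} → P u → Q u) → count P? ≤ count Q?
  count-mono P? Q? P⊆Q = count-injection P? (filter Q? (allFin n)) (λ {u} _ → u)
    (λ {u} p → ∈-filter⁺ Q? (∈-allFin u) (P⊆Q p)) (λ _ _ u≡v → u≡v)

  count-cong : {P Q : Fin n → Set} (P? : Decidable P) (Q? : Decidable Q) →
    (∀ {u} → P u → Q u) → (∀ {u} → Q u → P u) → count P? ≡ count Q?
  count-cong P? Q? P⊆Q Q⊆P = ≤-antisym (count-mono P? Q? P⊆Q) (count-mono Q? P? Q⊆P)

  count-split : {P Q : Fin n → Set} (P? : Decidable P) (Q? : Decidable Q) →
    count P? ≡ count (P? ∩? Q?) + count (P? ∩? ∁? Q?)
  count-split P? Q? = length-filter-split P? Q? (allFin n)

  count-U : count U? ≡ n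
  count-U = trans (cong length (filter-all U? (All.universal _ (allFin n)))) (length-tabulate id)

count-injection-⊎ : ∀ {n n₁ n₂} {P : Fin n → Set} {Q₁ : Fin n₁ → Set} {Q₂ : Fin n₂ → Set}
  (P? : Decidable P) (Q₁? : Decidable Q₁) (Q₂? : Decidable Q₂)
  (f : ∀ {u} → P u → Fin n₁ ⊎ Fin n₂) → (∀ {u} (p : P u) → [ Q₁ , Q₂ ]′ (f p)) →
  (∀ {u v} (p : P u) (q : P v) → f p ≡ f q → u ≡ v) → count P? ≤ count Q₁? + count Q₂?
count-injection-⊎ {n₁ = n₁} {n₂} {Q₁ = Q₁} {Q₂} P? Q₁? Q₂? f f∈Q f-inj =
  ≤-trans (count-injection P? (xs₁ ++ xs₂) f (λ p → ∈-targets (f p) (f∈Q p)) f-inj)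
          (≤-reflexive length-targets)
  where
  xs₁ xs₂ : List (Fin n₁ ⊎ Fin n₂)
  xs₁ = map inj₁ (filter Q₁? (allFin n₁))
  xs₂ = map inj₂ (filter Q₂? (allFin n₂))

  ∈-targets : ∀ x → [ Q₁ , Q₂ ]′ x → x ∈ xs₁ ++ xs₂
  ∈-targets (inj₁ x) q = ∈-++⁺ˡ (∈-map⁺ inj₁ (∈-filter⁺ Q₁? (∈-allFin x) q))
  ∈-targets (inj₂ x) q = ∈-++⁺ʳ xs₁ (∈-map⁺ inj₂ (∈-filter⁺ Q₂? (∈-allFin x) q))

  length-targets : length (xs₁ ++ xs₂) ≡ count Q₁? + count Q₂?
  length-targets = trans (length-++ xs₁)
    (cong₂ _+_ (length-map inj₁ (filter Q₁? (allFin n₁))) (length-map inj₂ (filter Q₂? (allFin n₂))))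

pattern rightward = fzero
pattern leftward  = fsuc fzero
pattern across    = fsuc (fsuc fzero)

module PathWithMatching {n k : ℕ} (m : Edges n k) (isMatching : IsAddedMatching m) where

  start end : Fin k → Fin n
  start i = proj₁ (lookup m i)
  end   i = proj₂ (lookup m i)

  loopless : ∀ i → start i ≢ end i
  loopless = proj₁ isMatching

  disjoint : ∀ i j u → Endpoint m i u → Endpoint m j u → i ≡ j
  disjoint = proj₂ (proj₂ isMatching)

  MatchedBy : Fin k → Fin n → Fin n → Set
  MatchedBy i u v = ((u ≡ start i) × (v ≡ end i)) ⊎ ((v ≡ start i) × (u ≡ end i))

  IsEndpoint : Fin n → Set
  IsEndpoint u = Σ (Fin k) λ i → Endpoint m i u

  IsEndpoint? : Decidable IsEndpoint
  IsEndpoint? u = Finₚ.any? λ i → (u Finₚ.≟ start i) ⊎-dec (u Finₚ.≟ end i)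

  Adj? : ∀ u v → Dec (Adj m u v)
  Adj? u v = ((toℕ u + 1 ≟ toℕ v) ⊎-dec (toℕ v + 1 ≟ toℕ u))
    ⊎-dec Finₚ.any? λ i → ((u Finₚ.≟ start i) ×-dec (v Finₚ.≟ end i))
                         ⊎-dec ((v Finₚ.≟ start i) ×-dec (u Finₚ.≟ end i))

  WithinDist? : ∀ j u v → Dec (WithinDist m j u v)
  WithinDist? zero    u v = u Finₚ.≟ v
  WithinDist? (suc j) u v = (u Finₚ.≟ v) ⊎-dec Finₚ.any? λ w → Adj? u w ×-dec WithinDist? j w v

  Adj-sym : ∀ {u v} → Adj m u v → Adj m v u
  Adj-sym (inj₁ (inj₁ e))      = inj₁ (inj₂ e)
  Adj-sym (inj₁ (inj₂ e))      = inj₁ (inj₁ e)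
  Adj-sym (inj₂ (i , inj₁ p))  = inj₂ (i , inj₂ p)
  Adj-sym (inj₂ (i , inj₂ p))  = inj₂ (i , inj₁ p)

  side : ∀ {u v} → Adj m u v → Fin 3
  side (inj₁ (inj₁ _)) = rightward
  side (inj₁ (inj₂ _)) = leftward
  side (inj₂ _)        = across

  across⇒IsEndpoint : ∀ {u v} (a : Adj m u v) → side a ≡ across → IsEndpoint u
  across⇒IsEndpoint (inj₂ (i , inj₁ (u≡ , _))) _ = i , inj₁ u≡
  across⇒IsEndpoint (inj₂ (i , inj₂ (_ , u≡))) _ = i , inj₂ u≡
  across⇒IsEndpoint (inj₁ (inj₁ _)) ()
  across⇒IsEndpoint (inj₁ (inj₂ _)) ()

  leftward⇒≢0 : ∀ {u v} (a : Adj m u v) → side a ≡ leftward → toℕ u ≢ 0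
  leftward⇒≢0 {v = v} (inj₁ (inj₂ v+1≡u)) _ u≡0 with m+n≡0⇒n≡0 (toℕ v) (trans v+1≡u u≡0)
  ... | ()

  partner-unique : ∀ {u v₁ v₂} i j → MatchedBy i u v₁ → MatchedBy j u v₂ → v₁ ≡ v₂
  partner-unique {u} i j p q with disjoint i j u (endpoint p) (endpoint q)
    where
    endpoint : ∀ {i v} → MatchedBy i u v → Endpoint m i u
    endpoint (inj₁ (u≡ , _)) = inj₁ u≡
    endpoint (inj₂ (_ , u≡)) = inj₂ u≡
  partner-unique i .i (inj₁ (_ , v₁≡)) (inj₁ (_ , v₂≡)) | refl = trans v₁≡ (sym v₂≡)
  partner-unique i .i (inj₂ (v₁≡ , _)) (inj₂ (v₂≡ , _)) | refl = trans v₁≡ (sym v₂≡)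
  partner-unique i .i (inj₁ (u≡ , _)) (inj₂ (_ , u≡′)) | refl = ⊥-elim (loopless i (trans (sym u≡) u≡′))
  partner-unique i .i (inj₂ (_ , u≡)) (inj₁ (u≡′ , _)) | refl = ⊥-elim (loopless i (trans (sym u≡′) u≡))

  side-injective : ∀ {u v₁ v₂} (a₁ : Adj m u v₁) (a₂ : Adj m u v₂) → side a₁ ≡ side a₂ → v₁ ≡ v₂
  side-injective (inj₁ (inj₁ e₁)) (inj₁ (inj₁ e₂)) _ = Finₚ.toℕ-injective (trans (sym e₁) e₂)
  side-injective (inj₁ (inj₂ e₁)) (inj₁ (inj₂ e₂)) _ =
    Finₚ.toℕ-injective (+-cancelʳ-≡ 1 _ _ (trans e₁ (sym e₂)))
  side-injective (inj₂ (i , p))   (inj₂ (j , q))   _ = partner-unique i j p q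
  side-injective (inj₁ (inj₁ _))  (inj₁ (inj₂ _))  ()
  side-injective (inj₁ (inj₁ _))  (inj₂ _)         ()
  side-injective (inj₁ (inj₂ _))  (inj₁ (inj₁ _))  ()
  side-injective (inj₁ (inj₂ _))  (inj₂ _)         ()
  side-injective (inj₂ _)         (inj₁ (inj₁ _))  ()
  side-injective (inj₂ _)         (inj₁ (inj₂ _))  ()

  endpoint-count : count IsEndpoint? ≤ k + k
  endpoint-count = ≤-trans (count-injection-⊎ IsEndpoint? U? U? label label∈U label-injective)
                           (≤-reflexive (cong₂ _+_ (count-U {k}) (count-U {k})))
    where
    label : ∀ {u} → IsEndpoint u → Fin k ⊎ Fin k
    label (i , inj₁ _) = inj₁ i
    label (i , inj₂ _) = inj₂ i

    label∈U : ∀ {u} (p : IsEndpoint u) → [ U , U ]′ (label p)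
    label∈U (_ , inj₁ _) = tt
    label∈U (_ , inj₂ _) = tt

    label-injective : ∀ {u v} (p : IsEndpoint u) (q : IsEndpoint v) → label p ≡ label q → u ≡ v
    label-injective (_ , inj₁ refl) (_ , inj₁ refl) eq = cong start (inj₁-injective eq)
    label-injective (_ , inj₂ refl) (_ , inj₂ refl) eq = cong end (inj₂-injective eq)
    label-injective (_ , inj₁ _)    (_ , inj₂ _)    ()
    label-injective (_ , inj₂ _)    (_ , inj₁ _)    ()

layer-arithmetic : ∀ k j E N → N ≤ 2 * k + j * suc (k + k) →
  N + 2 * (k + 1) * E ≤ 2 * (k + 1) * (j + E + 1)
layer-arithmetic k j E N N≤ = begin
  N + 2 * (k + 1) * E                                   ≤⟨ +-monoˡ-≤ _ (≤-trans N≤ (m≤m+n _ (2 + j))) ⟩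
  2 * k + j * suc (k + k) + (2 + j) + 2 * (k + 1) * E   ≡⟨ identity k j E ⟩
  2 * (k + 1) * (j + E + 1)                             ∎
  where
  open ≤-Reasoning
  identity : ∀ k j E → 2 * k + j * (1 + (k + k)) + (2 + j) + 2 * (k + 1) * E ≡ 2 * (k + 1) * (j + E + 1)
  identity = solve-∀

^≤2^[qD∸N] : ∀ q {a E N D} → a ≤ 2 ^ E → N + q * E ≤ q * D → a ^ q ≤ 2 ^ (q * D ∸ N)
^≤2^[qD∸N] q {a} {E} {N} {D} a≤2^E gap = begin
  a ^ q              ≤⟨ ^-monoˡ-≤ q a≤2^E ⟩
  (2 ^ E) ^ q        ≡⟨ ^-*-assoc 2 E q ⟩
  2 ^ (E * q)        ≤⟨ ^-monoʳ-≤ 2 Eq≤qD∸N ⟩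
  2 ^ (q * D ∸ N)    ∎
  where
  open ≤-Reasoning
  Eq≤qD∸N : E * q ≤ q * D ∸ N
  Eq≤qD∸N = ≤-trans (≤-reflexive (trans (*-comm E q) (sym (m+n∸m≡n N (q * E))))) (∸-monoˡ-≤ N gap)

Fin-≮-antisym : ∀ {n} {x y : Fin n} → ¬ toℕ x < toℕ y → ¬ toℕ y < toℕ x → x ≡ y
Fin-≮-antisym x≮y y≮x = Finₚ.≤-antisym (≮⇒≥ y≮x) (≮⇒≥ x≮y)

module Levels {n′ k : ℕ} (m : Edges (suc n′) k) (isMatching : IsAddedMatching m)
              (d : ℕ) (diam : DiamAtMost m d) where

  open PathWithMatching m isMatching

  V : Set
  V = Fin (suc n′)

  root : V
  root = fzero

  distance : (u : V) → Least λ j → WithinDist m j u root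
  distance u = least (λ j → WithinDist? j u root) d (diam u root)

  dist : V → ℕ
  dist u = Least.value (distance u)

  dist-minimal : ∀ {j u} → WithinDist m j u root → dist u ≤ j
  dist-minimal {u = u} = Least.minimal (distance u)

  dist-Adj : ∀ {u v} → Adj m u v → dist u ≤ suc (dist v)
  dist-Adj {v = v} a = dist-minimal (inj₂ (v , a , Least.holds (distance v)))

  dist≡0⇒root : ∀ {u} → dist u ≡ 0 → u ≡ root
  dist≡0⇒root {u} du = subst (λ j → WithinDist m j u root) du (Least.holds (distance u))

  dist≡suc⇒≢root : ∀ {u s} → dist u ≡ suc s → u ≢ root
  dist≡suc⇒≢root du refl = 0≢1+n (trans (sym (n≤0⇒n≡0 (dist-minimal {0} refl))) du)

  firstStep : ∀ {j u} → WithinDist m j u root → V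
  firstStep {zero}  {u} _               = u
  firstStep {suc j} {u} (inj₁ _)        = u
  firstStep {suc j}     (inj₂ (w , _))  = w

  firstStep-spec : ∀ {j s u} (walk : WithinDist m j u root) → j ≡ suc s → u ≢ root →
    Adj m u (firstStep walk) × WithinDist m s (firstStep walk) root
  firstStep-spec {zero}  _                     ()   _
  firstStep-spec {suc j} (inj₁ u≡root)         _    u≢root = ⊥-elim (u≢root u≡root)
  firstStep-spec {suc j} (inj₂ (_ , a , walk)) refl _      = a , walk

  parent : V → V
  parent u = firstStep (Least.holds (distance u))

  parent-spec : ∀ u {s} → dist u ≡ suc s → Adj m u (parent u) × dist (parent u) ≡ s
  parent-spec u du with firstStep-spec (Least.holds (distance u)) du (dist≡suc⇒≢root du)
  ... | a , walk = a , ≤-antisym (dist-minimal walk)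
                                 (≤-pred (subst (_≤ suc (dist (parent u))) du (dist-Adj a)))

  Child : V → V → Set
  Child w v = Adj m w v × dist v ≡ suc (dist w)

  Child? : ∀ w v → Dec (Child w v)
  Child? w v = Adj? w v ×-dec (dist v ≟ suc (dist w))

  parent-Child : ∀ u {s} → dist u ≡ suc s → Child (parent u) u
  parent-Child u du with parent-spec u du
  ... | a , dp = Adj-sym a , trans du (cong suc (sym dp))

  root-or-has-parent : ∀ w → w ≡ root ⊎ Σ ℕ λ s → dist w ≡ suc s
  root-or-has-parent w with dist w in dw
  ... | zero  = inj₁ (dist≡0⇒root dw)
  ... | suc s = inj₂ (s , refl)

  -- The side of w used by its parent, or the (empty) left side of the root.
  freeSide : ∀ w → Σ (Fin 3) λ s →
    (∀ {v} (c : Child w v) → side (proj₁ c) ≢ s) × (¬ IsEndpoint w → s ≢ across)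
  freeSide w with root-or-has-parent w
  ... | inj₁ refl     = leftward , (λ (a , _) left → leftward⇒≢0 a left refl) , λ _ ()
  ... | inj₂ (s , dw) with parent-spec w dw
  ...   | a , dp = side a , parent-not-child , λ ¬endpoint → ¬endpoint ∘ across⇒IsEndpoint a
    where
    parent-not-child : ∀ {v} (c : Child w v) → side (proj₁ c) ≢ side a
    parent-not-child (a′ , dv) same with side-injective a′ a same
    ... | refl = <⇒≢ (m<n⇒m<1+n (n<1+n s)) (trans (sym dp) (trans dv (cong suc dw)))

  side≢ : ∀ {w v₁ v₂} (a₁ : Adj m w v₁) (a₂ : Adj m w v₂) → v₁ ≢ v₂ → side a₁ ≢ side a₂
  side≢ a₁ a₂ v₁≢v₂ = v₁≢v₂ ∘ side-injective a₁ a₂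

  no-three-children : ∀ {w v₁ v₂ v₃} → Child w v₁ → Child w v₂ → Child w v₃ →
    v₁ ≢ v₂ → v₁ ≢ v₃ → v₂ ≢ v₃ → ⊥
  no-three-children {w} c₁@(a₁ , _) c₂@(a₂ , _) c₃@(a₃ , _) v₁≢v₂ v₁≢v₃ v₂≢v₃
    with s , free , _ ← freeSide w =
    1+n≰n (Unique⇒≤ {xs = side a₁ ∷ side a₂ ∷ side a₃ ∷ s ∷ []}
      ((side≢ a₁ a₂ v₁≢v₂ ∷ side≢ a₁ a₃ v₁≢v₃ ∷ free c₁ ∷ [])
      ∷ (side≢ a₂ a₃ v₂≢v₃ ∷ free c₂ ∷ [])
      ∷ (free c₃ ∷ [])
      ∷ [] ∷ []))

  one-child-unless-endpoint : ∀ {w v₁ v₂} → ¬ IsEndpoint w →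
    Child w v₁ → Child w v₂ → v₁ ≢ v₂ → ⊥
  one-child-unless-endpoint {w} ¬endpoint c₁@(a₁ , _) c₂@(a₂ , _) v₁≢v₂
    with s , free , s≢across ← freeSide w =
    1+n≰n (Unique⇒≤ {xs = side a₁ ∷ side a₂ ∷ s ∷ across ∷ []}
      ((side≢ a₁ a₂ v₁≢v₂ ∷ free c₁ ∷ (¬endpoint ∘ across⇒IsEndpoint a₁) ∷ [])
      ∷ (free c₂ ∷ (¬endpoint ∘ across⇒IsEndpoint a₂) ∷ [])
      ∷ (s≢across ¬endpoint ∷ [])
      ∷ [] ∷ []))

  HasOlderSibling : V → Set
  HasOlderSibling u = Σ V λ v → toℕ v < toℕ u × Child (parent u) v

  HasOlderSibling? : Decidable HasOlderSibling
  HasOlderSibling? u = Finₚ.any? λ v → (toℕ v <? toℕ u) ×-dec Child? (parent u) v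

  -- Charging each vertex of layer s + 1 to its parent becomes injective once children with
  -- an older sibling use a second copy of the vertex set; only endpoints have such children.
  charge : V → V ⊎ V
  charge u with HasOlderSibling? u
  ... | yes _ = inj₂ (parent u)
  ... | no  _ = inj₁ (parent u)

  AtLevel Below : ℕ → V → Set
  AtLevel s u = dist u ≡ s
  Below   t u = dist u < t

  AtLevel? : ∀ s → Decidable (AtLevel s)
  AtLevel? s u = dist u ≟ s

  Below? : ∀ t → Decidable (Below t)
  Below? t u = dist u <? t

  level : {P : V → Set} → Decidable P → ℕ → ℕ
  level P? s = count (P? ∩? AtLevel? s)

  below : {P : V → Set} → Decidable P → ℕ → ℕ
  below P? t = count (P? ∩? Below? t)

  charge-lands : ∀ u {s} → dist u ≡ suc s → [ U ∩ AtLevel s , IsEndpoint ∩ AtLevel s ]′ (charge u)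
  charge-lands u du with HasOlderSibling? u
  ... | no _ = tt , proj₂ (parent-spec u du)
  ... | yes (v , v<u , c) with IsEndpoint? (parent u)
  ...   | yes end = end , proj₂ (parent-spec u du)
  ...   | no ¬endpoint =
    ⊥-elim (one-child-unless-endpoint ¬endpoint c (parent-Child u du) (Finₚ.<⇒≢ v<u))

  ≡parent⇒Child : ∀ {w} u {s} → dist u ≡ suc s → w ≡ parent u → Child w u
  ≡parent⇒Child u du refl = parent-Child u du

  charge-injective : ∀ {u u′ s} → dist u ≡ suc s → dist u′ ≡ suc s →
    charge u ≡ charge u′ → u ≡ u′
  charge-injective {u} {u′} du du′ eq with HasOlderSibling? u | HasOlderSibling? u′
  ... | yes _ | no  _ with () ← eq
  ... | no  _ | yes _ with () ← eq
  ... | no ¬older | no ¬older′ = let same = inj₁-injective eq in Fin-≮-antisym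
    (λ u<u′ → ¬older′ (u , u<u′ , ≡parent⇒Child u du (sym same)))
    (λ u′<u → ¬older (u′ , u′<u , ≡parent⇒Child u′ du′ same))
  ... | yes (v , v<u , c) | yes (v′ , v′<u′ , c′) = let same = inj₂-injective eq in Fin-≮-antisym
    (λ u<u′ → no-three-children c (parent-Child u du) (≡parent⇒Child u′ du′ same)
                (Finₚ.<⇒≢ v<u) (Finₚ.<⇒≢ (<-trans v<u u<u′)) (Finₚ.<⇒≢ u<u′))
    (λ u′<u → no-three-children c′ (parent-Child u′ du′) (≡parent⇒Child u du (sym same))
                (Finₚ.<⇒≢ v′<u′) (Finₚ.<⇒≢ (<-trans v′<u′ u′<u)) (Finₚ.<⇒≢ u′<u))

  level-zero : level U? 0 ≤ 1
  level-zero = count-injection (U? ∩? AtLevel? 0) (root ∷ []) (λ _ → root) (λ _ → here refl)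
    (λ (_ , du) (_ , du′) _ → trans (dist≡0⇒root du) (sym (dist≡0⇒root du′)))

  level-suc : ∀ s → level U? (suc s) ≤ level U? s + level IsEndpoint? s
  level-suc s =
    count-injection-⊎ (U? ∩? AtLevel? (suc s)) (U? ∩? AtLevel? s) (IsEndpoint? ∩? AtLevel? s)
      (λ {u} _ → charge u) (λ {u} (_ , du) → charge-lands u du)
      (λ (_ , du) (_ , du′) → charge-injective du du′)

  level-IsEndpoint≤level : ∀ s → level IsEndpoint? s ≤ level U? s
  level-IsEndpoint≤level s =
    count-mono (IsEndpoint? ∩? AtLevel? s) (U? ∩? AtLevel? s) λ (_ , du) → tt , du

  below-zero : below U? 0 ≡ 0
  below-zero = n≤0⇒n≡0
    (count-injection (U? ∩? Below? 0) {B = ⊥} [] (λ { (_ , ()) }) (λ { (_ , ()) }) (λ { (_ , ()) }))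

  below-suc : ∀ {P : V → Set} (P? : Decidable P) t → below P? (suc t) ≡ below P? t + level P? t
  below-suc {P} P? t = trans (count-split P<1+t? (Below? t)) (cong₂ _+_ below-t at-t)
    where
    P<1+t? : Decidable (P ∩ Below (suc t))
    P<1+t? = P? ∩? Below? (suc t)

    below-t : count (P<1+t? ∩? Below? t) ≡ below P? t
    below-t = count-cong (P<1+t? ∩? Below? t) (P? ∩? Below? t)
      (λ ((p , _) , du<t) → p , du<t) (λ (p , du<t) → (p , m<n⇒m<1+n du<t) , du<t)

    at-t : count (P<1+t? ∩? ∁? (Below? t)) ≡ level P? t
    at-t = count-cong (P<1+t? ∩? ∁? (Below? t)) (P? ∩? AtLevel? t)
      (λ ((p , du<1+t) , du≮t) → p , ≤-antisym (≤-pred du<1+t) (≮⇒≥ du≮t))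
      (λ { (p , refl) → (p , ≤-refl) , <-irrefl refl })

  level≤2^ : ∀ s → level U? s ≤ 2 ^ s
  level≤2^ zero    = level-zero
  level≤2^ (suc s) = begin
    level U? (suc s)                   ≤⟨ level-suc s ⟩
    level U? s + level IsEndpoint? s   ≤⟨ +-monoʳ-≤ (level U? s) (level-IsEndpoint≤level s) ⟩
    level U? s + level U? s            ≤⟨ +-mono-≤ (level≤2^ s) (level≤2^ s) ⟩
    2 ^ s + 2 ^ s                      ≡⟨ cong (2 ^ s +_) (+-identityʳ (2 ^ s)) ⟨
    2 ^ suc s                          ∎
    where open ≤-Reasoning

  below<2^ : ∀ t → below U? t < 2 ^ t
  below<2^ zero    = s≤s (≤-reflexive below-zero)
  below<2^ (suc t) = begin-strict
    below U? (suc t)          ≡⟨ below-suc U? t ⟩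
    below U? t + level U? t   <⟨ +-mono-<-≤ (below<2^ t) (level≤2^ t) ⟩
    2 ^ t + 2 ^ t             ≡⟨ cong (2 ^ t +_) (+-identityʳ (2 ^ t)) ⟨
    2 ^ suc t                 ∎
    where open ≤-Reasoning

  level≤1+below-IsEndpoint : ∀ s → level U? s ≤ 1 + below IsEndpoint? s
  level≤1+below-IsEndpoint zero    = ≤-trans level-zero (m≤m+n 1 _)
  level≤1+below-IsEndpoint (suc s) = begin
    level U? (suc s)                                ≤⟨ level-suc s ⟩
    level U? s + level IsEndpoint? s                ≤⟨ +-monoˡ-≤ _ (level≤1+below-IsEndpoint s) ⟩
    1 + below IsEndpoint? s + level IsEndpoint? s   ≡⟨ cong suc (below-suc IsEndpoint? s) ⟨
    1 + below IsEndpoint? (suc s)                   ∎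
    where open ≤-Reasoning

  level≤1+2k : ∀ s → level U? s ≤ suc (k + k)
  level≤1+2k s = ≤-trans (level≤1+below-IsEndpoint s)
    (s≤s (≤-trans (count-mono (IsEndpoint? ∩? Below? s) IsEndpoint? proj₁) endpoint-count))

  below-+ : ∀ j t → below U? (j + t) ≤ below U? t + j * suc (k + k)
  below-+ zero    t = m≤m+n (below U? t) 0
  below-+ (suc j) t = begin
    below U? (suc (j + t))                       ≡⟨ below-suc U? (j + t) ⟩
    below U? (j + t) + level U? (j + t)          ≤⟨ +-mono-≤ (below-+ j t) (level≤1+2k (j + t)) ⟩
    below U? t + j * suc (k + k) + suc (k + k)   ≡⟨ +-assoc (below U? t) _ _ ⟩
    below U? t + (j * suc (k + k) + suc (k + k)) ≡⟨ cong (below U? t +_) (+-comm _ (suc (k + k))) ⟩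
    below U? t + suc j * suc (k + k)             ∎
    where open ≤-Reasoning

  all-below : suc n′ ≤ below U? (suc d)
  all-below = subst (_≤ below U? (suc d)) count-U
    (count-mono U? (U? ∩? Below? (suc d)) λ {u} _ → tt , s≤s (dist-minimal (diam u root)))

  order< : ∀ j t → j + t ≡ suc d → suc n′ < 2 ^ t + j * suc (k + k)
  order< j t j+t≡1+d = begin-strict
    suc n′                         ≤⟨ all-below ⟩
    below U? (suc d)               ≡⟨ cong (below U?) j+t≡1+d ⟨
    below U? (j + t)               ≤⟨ below-+ j t ⟩
    below U? t + j * suc (k + k)   <⟨ +-monoˡ-< _ (below<2^ t) ⟩
    2 ^ t + j * suc (k + k)        ∎
    where open ≤-Reasoning

  order-gap : ∀ E → 2 ^ E ≤ 2 * k → 2 * k ≤ suc n′ →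
    suc n′ + 2 * (k + 1) * E ≤ 2 * (k + 1) * (d + 2)
  order-gap E 2^E≤2k 2k≤N = subst (λ D → suc n′ + 2 * (k + 1) * E ≤ 2 * (k + 1) * D) j+E+1≡d+2
    (layer-arithmetic k j E (suc n′) (≤-trans (<⇒≤ (order< j E j+E≡1+d)) (+-monoˡ-≤ _ 2^E≤2k)))
    where
    E≤d : E ≤ d
    E≤d = ≮⇒≥ λ d<E → <-irrefl refl (begin-strict
      suc n′               <⟨ order< 0 (suc d) refl ⟩
      2 ^ suc d + 0        ≡⟨ +-identityʳ (2 ^ suc d) ⟩
      2 ^ suc d            ≤⟨ ^-monoʳ-≤ 2 d<E ⟩
      2 ^ E                ≤⟨ ≤-trans 2^E≤2k 2k≤N ⟩
      suc n′               ∎)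
      where open ≤-Reasoning
    j : ℕ
    j = suc d ∸ E
    j+E≡1+d : j + E ≡ suc d
    j+E≡1+d = m∸n+n≡m (m≤n⇒m≤1+n E≤d)
    j+E+1≡d+2 : j + E + 1 ≡ d + 2
    j+E+1≡d+2 = trans (cong (_+ 1) j+E≡1+d) (sym (+-suc d 1))

theorem1 : (n k : ℕ) → 2 ≤ n → 1 ≤ k → 2 * k ≤ n →
    (m : Edges n k) → IsAddedMatching m →
    (d : ℕ) → DiamAtMost m d →
    (n ≤ 2 * (k + 1) * (d + 2))
    × (suc k ^ (2 * (k + 1)) ≤ 2 ^ (2 * (k + 1) * (d + 2) ∸ n))
theorem1 (suc n′) k _ 1≤k 2k≤n m isMatching d diam
  with e , 2^e≤k , k<2^[1+e] ← log₂-bracket k 1≤k =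
  ≤-trans (m≤m+n _ _) gap , ^≤2^[qD∸N] (2 * (k + 1)) k<2^[1+e] gap
  where
  gap : suc n′ + 2 * (k + 1) * suc e ≤ 2 * (k + 1) * (d + 2)
  gap = Levels.order-gap m isMatching d diam (suc e) (*-monoʳ-≤ 2 2^e≤k) 2k≤n
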